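{- Let $\mathcal{K}=(D,X,H,f)$ be a constructible configuration and let $\mathcal{K}'=(D,X',H',f')$ be a configuration such that for some $v\in V(D)$ and some vertex $x_v$ of $H'$: $x_v$ has no neighbor in $H'$; $H=H'-x_v$; $X'_v=X_v\cup\{x_v\}$ and $X'_u=X_u$ for all $u\in V(D)\setminus\{v\}$; and $f'(x_v)=(0,0)$ and $f'(x)=f(x)$ for all $x\in V(H)\setminus\{x_v\}$. Then $\mathcal{K}'$ is constructible.
   Context: All digraphs are finite, without loops and parallel arcs (digons allowed); $d_D(v)=(d^+_D(v),d^-_D(v))$; pairs in $\mathbb{N}_0^2$ are added coordinatewise. Connected, block (maximal connected subdigraph with no vertex whose removal disconnects it) refer to the underlying graph. $D^\pm(G)$: replace each edge of undirected $G$ by a digon. Antidirected cycle: underlying graph a cycle, each vertex a source or a sink. Cover of $D$: pair $(X,H)$, $H$ disjoint from $D$, $X_v\subseteq V(H)$ pairwise disjoint with union $V(H)$, each independent in $H$, arcs of $H$ from $X_u$ to $X_v$ ($u\ne v$) a matching if $uv\in A(D)$, none otherwise. Transversal: $|T\cap X_v|=1$ for all $v$. For $U\subseteq V(H)$, $(X,H)/U$ is the cover $(X'',H[U])$ of $D[\{v:X_v\cap U\ne\varnothing\}]$ with $X''_v=X_v\cap U$. A cover is saturated if for every arc $uv$ the arcs from $X_u$ to $X_v$ form a perfect matching of $H[X_u\cup X_v]$. A configuration is $(D,X,H,f)$ with $(X,H)$ a cover of $D$ and $f:V(H)\to\mathbb{N}_0^2$. $(D,X,H,f)$ is constructible if one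 of: (I) $D$ is a block and there is a transversal $T$ with $(X,H)/T$ saturated, $f(x)=d_D(v)$ for $x\in T\cap X_v$, $f=(0,0)$ off $T$; (II) $D=D^\pm(K_n)$, $n\ge1$, $n_1+\dots+n_p=n-1$ with $n_i\in\mathbb{N}$, $p\ge1$, pairwise disjoint transversals $T_1,\dots,T_p$ with $(X,H)/T_i$ saturated, $f=(n_i,n_i)$ on $T_i$, $(0,0)$ elsewhere; (III) $D=D^\pm(C_n)$, $n\ge5$ odd, disjoint transversals $T_1,T_2$ with $(X,H)/T_i$ saturated, $f=(1,1)$ on $T_1\cup T_2$, $(0,0)$ elsewhere; (IV) $D=D^\pm(C_n)$, $n\ge4$ even, disjoint transversals $T_1,T_2$ with $H[T_1\cup T_2]=D^\pm(C_{2n})$, $f=(1,1)$ on $T_1\cup T_2$, $(0,0)$ elsewhere; (V) $D$ an antidirected cycle on $n\ge4$ vertices, $n$ even, disjoint transversals $T_1,T_2$ with $H[T_1\cup T_2]$ an antidirected cycle on $2n$ vertices, and for $x\in X_v\cap(T_1\cup T_2)$, $f(x)=(1,0)$ if $v$ is a source of $D$ and $(0,1)$ if $v$ is a sink, $f=(0,0)$ elsewhere; (VI) $(D,X,H,f)$ is obtained from disjoint constructible configurations $(D^i,X^i,H^i,f^i)$, $i=1,2$, with $|D^i|<|D|$, by identifying $v^1\in V(D^1)$ and $v^2\in V(D^2)$ into one vertex, choosing a bijection $\pi:X^1_{v^1}\to X^2_{v^2}$ and identifying each $x$ with $\pi(x)$ in $H$, with $f=f^i$ on $V(H^i)\setminus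 X^i_{v^i}$ and $f=f^1(x)+f^2(\pi(x))$ at the identified vertices. -}

module Defs where

open import Data.Nat using (ℕ; zero; suc; _+_; _*_; _∸_; _≤_; _<_; _≡ᵇ_)
open import Data.Fin using (Fin; toℕ) renaming (zero to fzero; suc to fsuc)
open import Data.Bool using (Bool; true; false; _∨_; _∧_; if_then_else_)
open import Data.Product using (Σ; Σ-syntax; ∃; ∃-syntax; _×_; _,_)
open import Data.Sum using (_⊎_)
open import Data.Unit using (⊤)
open import Relation.Binary.PropositionalEquality using (_≡_; _≢_)
open import Relation.Nullary using (¬_)
import Data.Product

countᵇ : ∀ {n} → (Fin n → Bool) → ℕ
countᵇ {zero}  p = 0
countᵇ {suc n} p = (if p fzero then 1 else 0) + countᵇ (λ i → p (fsuc i))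

sumF : ∀ {p} → (Fin p → ℕ) → ℕ
sumF {zero}  g = 0
sumF {suc p} g = g fzero + sumF (λ i → g (fsuc i))

Injective : ∀ {m n} → (Fin m → Fin n) → Set
Injective φ = ∀ a b → φ a ≡ φ b → a ≡ b

-- Digraphs: vertex set Fin n, arc relation Bool-valued (so no parallel
-- arcs), no loops; digons allowed.

record Digraph : Set where
  field
    n        : ℕ
    arc      : Fin n → Fin n → Bool
    loopless : ∀ v → arc v v ≡ false
open Digraph public

deg : (D : Digraph) → Fin (n D) → ℕ × ℕ
deg D v = countᵇ (λ w → arc D v w) , countᵇ (λ u → arc D u v)

Adj : ∀ {m} → (Fin m → Fin m → Bool) → Fin m → Fin m → Set
Adj a u w = (a u w ∨ a w u) ≡ true

data Reach {m} (a : Fin m → Fin m → Bool) (P : Fin m → Set)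
       : Fin m → Fin m → Set where
  here : ∀ {u} → P u → Reach a P u u
  step : ∀ {u w z} → P u → Adj a u w → Reach a P w z → Reach a P u z

Connected : Digraph → Set
Connected D = ∀ u w → Reach (arc D) (λ _ → ⊤) u w

ConnectedWithout : (D : Digraph) → Fin (n D) → Set
ConnectedWithout D c = ∀ u w → u ≢ c → w ≢ c → Reach (arc D) (λ z → z ≢ c) u w

Block : Digraph → Set
Block D = (1 ≤ n D) × Connected D × (∀ c → ConnectedWithout D c)

Source Sink : (D : Digraph) → Fin (n D) → Set
Source D v = ∀ u → arc D u v ≡ false
Sink   D v = ∀ w → arc D v w ≡ false

-- Concrete cycle C_m on Fin m (0 - 1 - ... - (m-1) - 0), meaningful for m ≥ 3.

cnext : ∀ {m} → Fin m → Fin m → Bool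
cnext {m} i j = (suc (toℕ i) ≡ᵇ toℕ j) ∨ ((suc (toℕ i) ≡ᵇ m) ∧ (toℕ j ≡ᵇ 0))

-- arcs of D^±(C_m) (= adjacency of C_m)
cycAdj : ∀ {m} → Fin m → Fin m → Bool
cycAdj i j = cnext i j ∨ cnext j i

-- Q holds for the digraph induced on the vertex set {x | S x} of an arc
-- relation a, transported to some enumeration Fin m of that set.
InducedHas : ∀ {k} → (a : Fin k → Fin k → Bool) → (S : Fin k → Set) → (m : ℕ)
           → ((Fin m → Fin m → Bool) → Set) → Set
InducedHas {k} a S m Q =
  Σ[ φ ∈ (Fin m → Fin k) ]
    Injective φ × (∀ i → S (φ i)) × (∀ x → S x → ∃[ i ] φ i ≡ x)
    × Q (λ i j → a (φ i) (φ j))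

IsDpmCycle : (m : ℕ) → (Fin m → Fin m → Bool) → Set
IsDpmCycle m b = ∀ i j → b i j ≡ cycAdj i j

IsAntiCycle : (m : ℕ) → (Fin m → Fin m → Bool) → Set
IsAntiCycle m b = (∀ i j → (b i j ∨ b j i) ≡ cycAdj i j)
                × (∀ i → (∀ j → b j i ≡ false) ⊎ (∀ j → b i j ≡ false))

DIsDpmCycle : Digraph → ℕ → Set
DIsDpmCycle D m = InducedHas (arc D) (λ _ → ⊤) m (IsDpmCycle m)

DIsAntiCycle : Digraph → ℕ → Set
DIsAntiCycle D m = InducedHas (arc D) (λ _ → ⊤) m (IsAntiCycle m)

DIsDpmComplete : Digraph → ℕ → Set
DIsDpmComplete D m = (n D ≡ m) × (1 ≤ m) × (∀ u w → u ≢ w → arc D u w ≡ true)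

Even Odd : ℕ → Set
Even m = ∃[ k ] m ≡ 2 * k
Odd  m = ∃[ k ] m ≡ suc (2 * k)

-- Covers. X x = v means x ∈ X_v (so the X_v partition V(H)).

record Cover (D : Digraph) : Set where
  field
    H       : Digraph
    X       : Fin (n H) → Fin (n D)
    indep   : ∀ x y → arc H x y ≡ true → X x ≢ X y
    onlyArc : ∀ x y → arc H x y ≡ true → arc D (X x) (X y) ≡ true
    matchL  : ∀ x y y' → arc H x y ≡ true → arc H x y' ≡ true → X y ≡ X y' → y ≡ y'
    matchR  : ∀ x x' y → arc H x y ≡ true → arc H x' y ≡ true → X x ≡ X x' → x ≡ x'
open Cover public

VH : ∀ {D} → Cover D → Set
VH C = Fin (n (H C))

-- a transversal, given as the section v ↦ (unique element of T ∩ X_v)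
Transversal : ∀ {D} → Cover D → Set
Transversal {D} C = Σ[ t ∈ (Fin (n D) → VH C) ] (∀ v → X C (t v) ≡ v)

tr : ∀ {D} (C : Cover D) → Transversal C → Fin (n D) → VH C
tr C (t , _) = t

InT : ∀ {D} (C : Cover D) → VH C → Transversal C → Set
InT C x T = ∃[ v ] tr C T v ≡ x

NotInT : ∀ {D} (C : Cover D) → VH C → Transversal C → Set
NotInT C x T = ¬ (InT C x T)

Saturated : ∀ {D} (C : Cover D) → Transversal C → Set
Saturated {D} C T = ∀ u w → arc D u w ≡ true → arc (H C) (tr C T u) (tr C T w) ≡ true

Disjoint : ∀ {D} (C : Cover D) → Transversal C → Transversal C → Set
Disjoint C T T' = ∀ u w → tr C T u ≢ tr C T' w

record Config : Set where
  constructor config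
  field
    D   : Digraph
    cov : Cover D
    f   : Fin (n (H cov)) → ℕ × ℕ
open Config public

-- (VI): K is obtained from K1, K2 by identifying v1 ∈ V(D1) with v2 ∈ V(D2)
-- and X1_{v1} with X2_{v2} along a bijection (described via the two
-- embeddings of the pieces into K).

Glue : Config → Config → Config → Set
Glue (config D1 C1 f1) (config D2 C2 f2) (config D C f) =
  Σ[ v1 ∈ Fin (n D1) ] Σ[ v2 ∈ Fin (n D2) ]
  Σ[ φ1 ∈ (Fin (n D1) → Fin (n D)) ] Σ[ φ2 ∈ (Fin (n D2) → Fin (n D)) ]
  Σ[ ψ1 ∈ (VH C1 → VH C) ] Σ[ ψ2 ∈ (VH C2 → VH C) ]
  ( Injective φ1 × Injective φ2
  × φ1 v1 ≡ φ2 v2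
  × (∀ a b → φ1 a ≡ φ2 b → a ≡ v1 × b ≡ v2)
  × (∀ u → (∃[ a ] φ1 a ≡ u) ⊎ (∃[ b ] φ2 b ≡ u))
  × (∀ a b → arc D (φ1 a) (φ1 b) ≡ arc D1 a b)
  × (∀ a b → arc D (φ2 a) (φ2 b) ≡ arc D2 a b)
  × (∀ u w → arc D u w ≡ true →
        (∃[ a ] ∃[ b ] (φ1 a ≡ u × φ1 b ≡ w))
      ⊎ (∃[ a ] ∃[ b ] (φ2 a ≡ u × φ2 b ≡ w)))
  × Injective ψ1 × Injective ψ2
  × (∀ x → X C (ψ1 x) ≡ φ1 (X C1 x))
  × (∀ y → X C (ψ2 y) ≡ φ2 (X C2 y))
  × (∀ x → X C1 x ≡ v1 → ∃[ y ] ψ2 y ≡ ψ1 x)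
  × (∀ y → X C2 y ≡ v2 → ∃[ x ] ψ1 x ≡ ψ2 y)
  × (∀ z → (∃[ x ] ψ1 x ≡ z) ⊎ (∃[ y ] ψ2 y ≡ z))
  × (∀ x y → arc (H C) (ψ1 x) (ψ1 y) ≡ arc (H C1) x y)
  × (∀ x y → arc (H C) (ψ2 x) (ψ2 y) ≡ arc (H C2) x y)
  × (∀ z z' → arc (H C) z z' ≡ true →
        (∃[ x ] ∃[ y ] (ψ1 x ≡ z × ψ1 y ≡ z'))
      ⊎ (∃[ x ] ∃[ y ] (ψ2 x ≡ z × ψ2 y ≡ z')))
  × (∀ x → X C1 x ≢ v1 → f (ψ1 x) ≡ f1 x)
  × (∀ y → X C2 y ≢ v2 → f (ψ2 y) ≡ f2 y)
  × (∀ x y → ψ1 x ≡ ψ2 y → f (ψ1 x) ≡ (Data.Product.proj₁ (f1 x) + Data.Product.proj₁ (f2 y)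
                                         , Data.Product.proj₂ (f1 x) + Data.Product.proj₂ (f2 y))))

data Constructible : Config → Set where
  typeI : ∀ D (C : Cover D) f (T : Transversal C)
        → Block D → Saturated C T
        → (∀ v → f (tr C T v) ≡ deg D v)
        → (∀ x → NotInT C x T → f x ≡ (0 , 0))
        → Constructible (config D C f)
  typeII : ∀ D (C : Cover D) f (m p : ℕ) (ns : Fin p → ℕ) (Ts : Fin p → Transversal C)
        → DIsDpmComplete D m → 1 ≤ p
        → (∀ i → 1 ≤ ns i) → sumF ns ≡ m ∸ 1
        → (∀ i j → i ≢ j → Disjoint C (Ts i) (Ts j))
        → (∀ i → Saturated C (Ts i))
        → (∀ i v → f (tr C (Ts i) v) ≡ (ns i , ns i))
        → (∀ x → (∀ i → NotInT C x (Ts i)) → f x ≡ (0 , 0))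
        → Constructible (config D C f)
  typeIII : ∀ D (C : Cover D) f (m : ℕ) (T1 T2 : Transversal C)
        → DIsDpmCycle D m → 5 ≤ m → Odd m
        → Disjoint C T1 T2 → Saturated C T1 → Saturated C T2
        → (∀ v → f (tr C T1 v) ≡ (1 , 1)) → (∀ v → f (tr C T2 v) ≡ (1 , 1))
        → (∀ x → NotInT C x T1 → NotInT C x T2 → f x ≡ (0 , 0))
        → Constructible (config D C f)
  typeIV : ∀ D (C : Cover D) f (m : ℕ) (T1 T2 : Transversal C)
        → DIsDpmCycle D m → 4 ≤ m → Even m
        → Disjoint C T1 T2
        → InducedHas (arc (H C)) (λ x → InT C x T1 ⊎ InT C x T2) (2 * m) (IsDpmCycle (2 * m))
        → (∀ v → f (tr C T1 v) ≡ (1 , 1)) → (∀ v → f (tr C T2 v) ≡ (1 , 1))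
        → (∀ x → NotInT C x T1 → NotInT C x T2 → f x ≡ (0 , 0))
        → Constructible (config D C f)
  typeV : ∀ D (C : Cover D) f (m : ℕ) (T1 T2 : Transversal C)
        → DIsAntiCycle D m → 4 ≤ m → Even m
        → Disjoint C T1 T2
        → InducedHas (arc (H C)) (λ x → InT C x T1 ⊎ InT C x T2) (2 * m) (IsAntiCycle (2 * m))
        → (∀ v → Source D v → f (tr C T1 v) ≡ (1 , 0) × f (tr C T2 v) ≡ (1 , 0))
        → (∀ v → Sink D v → f (tr C T1 v) ≡ (0 , 1) × f (tr C T2 v) ≡ (0 , 1))
        → (∀ x → NotInT C x T1 → NotInT C x T2 → f x ≡ (0 , 0))
        → Constructible (config D C f)
  typeVI : ∀ K1 K2 K
        → Constructible K1 → Constructible K2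
        → n (D K1) < n (D K) → n (D K2) < n (D K)
        → Glue K1 K2 K
        → Constructible K

{-# OPTIONS --safe #-}
-- In cases (I)–(V) the transversals of H are carried by the
-- embedding ι : H → H' to transversals of H' that are still saturated, disjoint and induce the
-- same cycle; the new vertex x_v lies on none of them and has weight (0,0), so K' is built by
-- the same rule. In case (VI), v comes from one of the two pieces; adding an isolated vertex to
-- that piece's cover keeps it constructible by induction, and gluing again yields K'. When v is
-- the identified vertex, both pieces get a new vertex and π matches them, with weight (0,0)+(0,0).
module Submission where

open import Defs
open import Data.Nat using (ℕ; suc; _+_; _*_)
open import Data.Nat.Properties using (+-comm)
open import Data.Fin using (Fin; _≟_) renaming (zero to fzero; suc to fsuc)
open import Data.Fin.Properties using (suc-injective)
open import Data.Bool using (Bool; true; false; _∨_)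
open import Data.Product using (_×_; _,_; ∃-syntax; proj₁; proj₂)
import Data.Product as Product
open import Data.Sum using (_⊎_; inj₁; inj₂)
import Data.Sum as Sum
open import Function using (_∘_)
open import Relation.Nullary using (yes; no)
open import Relation.Nullary.Negation using (contradiction)
open import Relation.Binary.PropositionalEquality
  using (_≡_; _≢_; refl; sym; trans; cong; cong₂)

InImage : ∀ {A B : Set} → (A → B) → B → Set
InImage σ z = ∃[ x ] σ x ≡ z

PairInImage : ∀ {A B : Set} → (A → B) → B → B → Set
PairInImage σ z z' = ∃[ x ] ∃[ y ] (σ x ≡ z × σ y ≡ z')

record IsolatedExtension {D : Digraph} (C : Cover D) (f : VH C → ℕ × ℕ)
                         (C' : Cover D) (f' : VH C' → ℕ × ℕ) : Set where
  constructor isolatedExtension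
  field
    v            : Fin (n D)
    new          : VH C'
    ι            : VH C → VH C'
    new-isolated : ∀ y → arc (H C') new y ≡ false × arc (H C') y new ≡ false
    ι-injective  : Injective ι
    ι≢new        : ∀ a → ι a ≢ new
    ι-onto       : ∀ y → y ≢ new → InImage ι y
    ι-arc        : ∀ a b → arc (H C') (ι a) (ι b) ≡ arc (H C) a b
    X-new        : X C' new ≡ v
    X-ι          : ∀ a → X C' (ι a) ≡ X C a
    f-new        : f' new ≡ (0 , 0)
    f-ι          : ∀ a → f' (ι a) ≡ f a

module Extension {D : Digraph} {C C' : Cover D} {f : VH C → ℕ × ℕ} {f' : VH C' → ℕ × ℕ}
                 (E : IsolatedExtension C f C' f') where
  open IsolatedExtension E public

  new-or-ι : ∀ z → z ≡ new ⊎ InImage ι z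
  new-or-ι z with z ≟ new
  ... | yes z≡new = inj₁ z≡new
  ... | no  z≢new = inj₂ (ι-onto z z≢new)

  arc-ι-preimage : ∀ z z' → arc (H C') z z' ≡ true
                 → ∃[ a ] ∃[ b ] ι a ≡ z × ι b ≡ z' × arc (H C) a b ≡ true
  arc-ι-preimage z z' z→z' with new-or-ι z | new-or-ι z'
  ... | inj₁ refl | _ = contradiction (trans (sym (proj₁ (new-isolated z'))) z→z') λ ()
  ... | inj₂ _ | inj₁ refl = contradiction (trans (sym (proj₂ (new-isolated z))) z→z') λ ()
  ... | inj₂ (a , refl) | inj₂ (b , refl) = a , b , refl , refl , trans (sym (ι-arc a b)) z→z'

  f'-vanishes : ∀ x → (∀ a → ι a ≡ x → f a ≡ (0 , 0)) → f' x ≡ (0 , 0)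
  f'-vanishes x f-zero with new-or-ι x
  ... | inj₁ refl = f-new
  ... | inj₂ (a , refl) = trans (f-ι a) (f-zero a refl)

  transversal : Transversal C → Transversal C'
  transversal (t , t-section) = ι ∘ t , λ u → trans (X-ι (t u)) (t-section u)

  transversal-saturated : ∀ T → Saturated C T → Saturated C' (transversal T)
  transversal-saturated T sat u w u→w = trans (ι-arc _ _) (sat u w u→w)

  transversal-disjoint : ∀ T T' → Disjoint C T T' → Disjoint C' (transversal T) (transversal T')
  transversal-disjoint T T' disj u w eq = disj u w (ι-injective _ _ eq)

  transversal-f : ∀ T u → f' (tr C' (transversal T) u) ≡ f (tr C T u)
  transversal-f T u = f-ι (tr C T u)

  inT-ι : ∀ T {a} → InT C a T → InT C' (ι a) (transversal T)
  inT-ι T (u , eq) = u , cong ι eq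

  notInT-ι : ∀ T {a x} → ι a ≡ x → NotInT C' x (transversal T) → NotInT C a T
  notInT-ι T refl a∉T' a∈T = a∉T' (inT-ι T a∈T)

  f'-vanishes-outside₂ : ∀ T₁ T₂ → (∀ a → NotInT C a T₁ → NotInT C a T₂ → f a ≡ (0 , 0))
    → ∀ x → NotInT C' x (transversal T₁) → NotInT C' x (transversal T₂) → f' x ≡ (0 , 0)
  f'-vanishes-outside₂ T₁ T₂ f-off x x∉T₁ x∉T₂ =
    f'-vanishes x λ a ιa≡x → f-off a (notInT-ι T₁ ιa≡x x∉T₁) (notInT-ι T₂ ιa≡x x∉T₂)

  inducedHas-transversals : ∀ T₁ T₂ m (Q : (Fin m → Fin m → Bool) → Set)
    → (∀ {b b'} → (∀ i j → b i j ≡ b' i j) → Q b → Q b')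
    → InducedHas (arc (H C)) (λ x → InT C x T₁ ⊎ InT C x T₂) m Q
    → InducedHas (arc (H C')) (λ x → InT C' x (transversal T₁) ⊎ InT C' x (transversal T₂)) m Q
  inducedHas-transversals T₁ T₂ m Q Q-resp (φ , φ-inj , φ-in , φ-onto , Qφ) =
    ι ∘ φ , (λ i j eq → φ-inj i j (ι-injective _ _ eq)) ,
    (λ i → Sum.map (inT-ι T₁) (inT-ι T₂) (φ-in i)) , onto , Q-resp (λ i j → sym (ι-arc (φ i) (φ j))) Qφ
    where
    onto : ∀ x → InT C' x (transversal T₁) ⊎ InT C' x (transversal T₂) → InImage (ι ∘ φ) x
    onto x (inj₁ (u , refl)) = Product.map₂ (cong ι) (φ-onto _ (inj₁ (u , refl)))
    onto x (inj₂ (u , refl)) = Product.map₂ (cong ι) (φ-onto _ (inj₂ (u , refl)))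

isDpmCycle-resp : ∀ {m b b'} → (∀ i j → b i j ≡ b' i j) → IsDpmCycle m b → IsDpmCycle m b'
isDpmCycle-resp b≗b' cyc i j = trans (sym (b≗b' i j)) (cyc i j)

isAntiCycle-resp : ∀ {m b b'} → (∀ i j → b i j ≡ b' i j) → IsAntiCycle m b → IsAntiCycle m b'
isAntiCycle-resp b≗b' (underlying , orient) =
  (λ i j → trans (sym (cong₂ _∨_ (b≗b' i j) (b≗b' j i))) (underlying i j)) ,
  (λ i → Sum.map (λ src j → trans (sym (b≗b' j i)) (src j))
                 (λ snk j → trans (sym (b≗b' i j)) (snk j)) (orient i))

addIsolated : Digraph → Digraph
addIsolated G = record { n = suc (n G) ; arc = arc⁺ ; loopless = loopless⁺ }
  where
  arc⁺ : Fin (suc (n G)) → Fin (suc (n G)) → Bool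
  arc⁺ (fsuc x) (fsuc y) = arc G x y
  arc⁺ _        _        = false
  loopless⁺ : ∀ x → arc⁺ x x ≡ false
  loopless⁺ fzero    = refl
  loopless⁺ (fsuc x) = loopless G x

addIsolatedCover : ∀ {D} → Cover D → Fin (n D) → Cover D
addIsolatedCover {D} C a = record
  { H = addIsolated (H C) ; X = X⁺ ; indep = indep⁺ ; onlyArc = onlyArc⁺
  ; matchL = matchL⁺ ; matchR = matchR⁺ }
  where
  arc⁺ : Fin (suc (n (H C))) → Fin (suc (n (H C))) → Bool
  arc⁺ = arc (addIsolated (H C))
  X⁺ : Fin (suc (n (H C))) → Fin (n D)
  X⁺ fzero    = a
  X⁺ (fsuc x) = X C x
  indep⁺ : ∀ x y → arc⁺ x y ≡ true → X⁺ x ≢ X⁺ y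
  indep⁺ (fsuc x) (fsuc y) = indep C x y
  onlyArc⁺ : ∀ x y → arc⁺ x y ≡ true → arc D (X⁺ x) (X⁺ y) ≡ true
  onlyArc⁺ (fsuc x) (fsuc y) = onlyArc C x y
  matchL⁺ : ∀ x y y' → arc⁺ x y ≡ true → arc⁺ x y' ≡ true → X⁺ y ≡ X⁺ y' → y ≡ y'
  matchL⁺ (fsuc x) (fsuc y) (fsuc y') x→y x→y' eq = cong fsuc (matchL C x y y' x→y x→y' eq)
  matchR⁺ : ∀ x x' y → arc⁺ x y ≡ true → arc⁺ x' y ≡ true → X⁺ x ≡ X⁺ x' → x ≡ x'
  matchR⁺ (fsuc x) (fsuc x') (fsuc y) x→y x'→y eq = cong fsuc (matchR C x x' y x→y x'→y eq)

zeroAtNew : ∀ {m} → (Fin m → ℕ × ℕ) → Fin (suc m) → ℕ × ℕ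
zeroAtNew f fzero    = (0 , 0)
zeroAtNew f (fsuc x) = f x

addIsolatedConfig : (K : Config) → Fin (n (D K)) → Config
addIsolatedConfig K a = config (D K) (addIsolatedCover (cov K) a) (zeroAtNew (f K))

addIsolated-extension : ∀ K a
  → IsolatedExtension (cov K) (f K) (cov (addIsolatedConfig K a)) (f (addIsolatedConfig K a))
addIsolated-extension K a = isolatedExtension a fzero fsuc (λ y → refl , new-isolatedˡ y)
  (λ x y → suc-injective) (λ x ()) onto (λ x y → refl) refl (λ x → refl) refl (λ x → refl)
  where
  new-isolatedˡ : ∀ y → arc (addIsolated (H (cov K))) y fzero ≡ false
  new-isolatedˡ fzero    = refl
  new-isolatedˡ (fsuc y) = refl
  onto : ∀ y → y ≢ fzero → InImage fsuc y
  onto fzero    y≢0 = contradiction refl y≢0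
  onto (fsuc x) _   = x , refl

_⊕_ : ℕ × ℕ → ℕ × ℕ → ℕ × ℕ
(a , b) ⊕ (c , d) = (a + c , b + d)

⊕-comm : ∀ p q → p ⊕ q ≡ q ⊕ p
⊕-comm (a , b) (c , d) = cong₂ _,_ (+-comm a c) (+-comm b d)

record VertexGluing (D₁ D₂ D : Digraph) : Set where
  constructor vertexGluing
  field
    v₁ : Fin (n D₁)
    v₂ : Fin (n D₂)
    φ₁ : Fin (n D₁) → Fin (n D)
    φ₂ : Fin (n D₂) → Fin (n D)
    φ₁-injective : Injective φ₁
    φ₂-injective : Injective φ₂
    φ-glued      : φ₁ v₁ ≡ φ₂ v₂
    φ-overlap    : ∀ a b → φ₁ a ≡ φ₂ b → a ≡ v₁ × b ≡ v₂
    φ-cover      : ∀ u → InImage φ₁ u ⊎ InImage φ₂ u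
    φ₁-arc       : ∀ a b → arc D (φ₁ a) (φ₁ b) ≡ arc D₁ a b
    φ₂-arc       : ∀ a b → arc D (φ₂ a) (φ₂ b) ≡ arc D₂ a b
    φ-arcs       : ∀ u w → arc D u w ≡ true
                 → PairInImage φ₁ u w ⊎ PairInImage φ₂ u w

  location : ∀ u → φ₁ v₁ ≡ u ⊎ (∃[ a ] a ≢ v₁ × φ₁ a ≡ u) ⊎ (∃[ b ] b ≢ v₂ × φ₂ b ≡ u)
  location u with φ-cover u
  ... | inj₁ (a , φ₁a≡u) with a ≟ v₁
  ...   | yes refl  = inj₁ φ₁a≡u
  ...   | no  a≢v₁ = inj₂ (inj₁ (a , a≢v₁ , φ₁a≡u))
  location u | inj₂ (b , φ₂b≡u) with b ≟ v₂
  ...   | yes refl  = inj₁ (trans φ-glued φ₂b≡u)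
  ...   | no  b≢v₂ = inj₂ (inj₂ (b , b≢v₂ , φ₂b≡u))

VertexGluing-sym : ∀ {D₁ D₂ D} → VertexGluing D₁ D₂ D → VertexGluing D₂ D₁ D
VertexGluing-sym (vertexGluing v₁ v₂ φ₁ φ₂ φ₁-inj φ₂-inj glued overlaps cover φ₁-arc φ₂-arc arcs) =
  vertexGluing v₂ v₁ φ₂ φ₁ φ₂-inj φ₁-inj (sym glued)
    (λ b a eq → Product.swap (overlaps a b (sym eq))) (Sum.swap ∘ cover)
    φ₂-arc φ₁-arc (λ u w u→w → Sum.swap (arcs u w u→w))

record Gluing (K₁ K₂ K : Config) : Set where
  constructor gluing
  field
    base : VertexGluing (D K₁) (D K₂) (D K)
  open VertexGluing base public
  field
    ψ₁ : VH (cov K₁) → VH (cov K)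
    ψ₂ : VH (cov K₂) → VH (cov K)
    ψ₁-injective : Injective ψ₁
    ψ₂-injective : Injective ψ₂
    ψ₁-X         : ∀ x → X (cov K) (ψ₁ x) ≡ φ₁ (X (cov K₁) x)
    ψ₂-X         : ∀ y → X (cov K) (ψ₂ y) ≡ φ₂ (X (cov K₂) y)
    ψ₁-glued     : ∀ x → X (cov K₁) x ≡ v₁ → InImage ψ₂ (ψ₁ x)
    ψ₂-glued     : ∀ y → X (cov K₂) y ≡ v₂ → InImage ψ₁ (ψ₂ y)
    ψ-cover      : ∀ z → InImage ψ₁ z ⊎ InImage ψ₂ z
    ψ₁-arc       : ∀ x y → arc (H (cov K)) (ψ₁ x) (ψ₁ y) ≡ arc (H (cov K₁)) x y
    ψ₂-arc       : ∀ x y → arc (H (cov K)) (ψ₂ x) (ψ₂ y) ≡ arc (H (cov K₂)) x y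
    ψ-arcs       : ∀ z z' → arc (H (cov K)) z z' ≡ true
                 → PairInImage ψ₁ z z' ⊎ PairInImage ψ₂ z z'
    ψ₁-f         : ∀ x → X (cov K₁) x ≢ v₁ → f K (ψ₁ x) ≡ f K₁ x
    ψ₂-f         : ∀ y → X (cov K₂) y ≢ v₂ → f K (ψ₂ y) ≡ f K₂ y
    ψ-f-glued    : ∀ x y → ψ₁ x ≡ ψ₂ y → f K (ψ₁ x) ≡ f K₁ x ⊕ f K₂ y

fromGlue : ∀ {K₁ K₂ K} → Glue K₁ K₂ K → Gluing K₁ K₂ K
fromGlue (a , b , c , d , e , f , g , h , i , j , k , l , m , n , o , p , q , r , s , t , u , v , w , x , y , z , α) =
  gluing (vertexGluing a b c d g h i j k l m n) e f o p q r s t u v w x y z α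

toGlue : ∀ {K₁ K₂ K} → Gluing K₁ K₂ K → Glue K₁ K₂ K
toGlue (gluing (vertexGluing a b c d g h i j k l m n) e f o p q r s t u v w x y z α) =
  a , b , c , d , e , f , g , h , i , j , k , l , m , n , o , p , q , r , s , t , u , v , w , x , y , z , α

Gluing-sym : ∀ {K₁ K₂ K} → Gluing K₁ K₂ K → Gluing K₂ K₁ K
Gluing-sym {K₁} {K₂} {K} G = record
  { base = VertexGluing-sym base
  ; ψ₁ = ψ₂ ; ψ₂ = ψ₁
  ; ψ₁-injective = ψ₂-injective ; ψ₂-injective = ψ₁-injective
  ; ψ₁-X = ψ₂-X ; ψ₂-X = ψ₁-X
  ; ψ₁-glued = ψ₂-glued ; ψ₂-glued = ψ₁-glued
  ; ψ-cover = Sum.swap ∘ ψ-cover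
  ; ψ₁-arc = ψ₂-arc ; ψ₂-arc = ψ₁-arc
  ; ψ-arcs = λ z z' z→z' → Sum.swap (ψ-arcs z z' z→z')
  ; ψ₁-f = ψ₂-f ; ψ₂-f = ψ₁-f
  ; ψ-f-glued = λ y x eq →
      trans (cong (f K) eq) (trans (ψ-f-glued x y (sym eq)) (⊕-comm (f K₁ x) (f K₂ y)))
  }
  where open Gluing G

module GluingExtension {D : Digraph} {C C' : Cover D} {f : VH C → ℕ × ℕ} {f' : VH C' → ℕ × ℕ}
                       (E : IsolatedExtension C f C' f') where
  open Extension E

  lift : ∀ {m} → (Fin m → VH C) → Fin (suc m) → VH C'
  lift ψ fzero    = new
  lift ψ (fsuc x) = ι (ψ x)

  lift-injective : ∀ {m} {ψ : Fin m → VH C} → Injective ψ → Injective (lift ψ)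
  lift-injective ψ-inj fzero    fzero    _  = refl
  lift-injective ψ-inj fzero    (fsuc y) eq = contradiction (sym eq) (ι≢new _)
  lift-injective ψ-inj (fsuc x) fzero    eq = contradiction eq (ι≢new _)
  lift-injective ψ-inj (fsuc x) (fsuc y) eq = cong fsuc (ψ-inj x y (ι-injective _ _ eq))

  lift-arc : ∀ {G : Digraph} {ψ : Fin (n G) → VH C}
           → (∀ x y → arc (H C) (ψ x) (ψ y) ≡ arc G x y)
           → ∀ x y → arc (H C') (lift ψ x) (lift ψ y) ≡ arc (addIsolated G) x y
  lift-arc ψ-arc fzero    y        = proj₁ (new-isolated _)
  lift-arc ψ-arc (fsuc x) fzero    = proj₂ (new-isolated _)
  lift-arc ψ-arc (fsuc x) (fsuc y) = trans (ι-arc _ _) (ψ-arc x y)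

  lift-X : ∀ {D₁} {C₁ : Cover D₁} {φ : Fin (n D₁) → Fin (n D)} {ψ : VH C₁ → VH C} {a}
         → φ a ≡ v → (∀ x → X C (ψ x) ≡ φ (X C₁ x))
         → ∀ x → X C' (lift ψ x) ≡ φ (X (addIsolatedCover C₁ a) x)
  lift-X φa≡v ψ-X fzero    = trans X-new (sym φa≡v)
  lift-X φa≡v ψ-X (fsuc x) = trans (X-ι _) (ψ-X x)

  lift-f : ∀ {m} {ψ : Fin m → VH C} {f₁ : Fin m → ℕ × ℕ} {P : Fin (suc m) → Set}
         → (∀ x → P (fsuc x) → f (ψ x) ≡ f₁ x)
         → ∀ x → P x → f' (lift ψ x) ≡ zeroAtNew f₁ x
  lift-f ψ-f fzero    _ = f-new
  lift-f ψ-f (fsuc x) p = trans (f-ι _) (ψ-f x p)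

  module _ {m : ℕ} {B B' : Set} {ψ₁ : Fin m → VH C} {ψ₂ : B → VH C} {σ₂ : B' → VH C'}
           (σ₂-covers : ∀ y → InImage σ₂ (ι (ψ₂ y))) where

    lift-cover : (∀ z → InImage ψ₁ z ⊎ InImage ψ₂ z) → ∀ z → InImage (lift ψ₁) z ⊎ InImage σ₂ z
    lift-cover ψ-cover z with new-or-ι z
    ... | inj₁ refl = inj₁ (fzero , refl)
    ... | inj₂ (p , refl) with ψ-cover p
    ...   | inj₁ (x , refl) = inj₁ (fsuc x , refl)
    ...   | inj₂ (y , refl) = inj₂ (σ₂-covers y)

    lift-arcs : (∀ z z' → arc (H C) z z' ≡ true → PairInImage ψ₁ z z' ⊎ PairInImage ψ₂ z z')
              → ∀ z z' → arc (H C') z z' ≡ true → PairInImage (lift ψ₁) z z' ⊎ PairInImage σ₂ z z'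
    lift-arcs ψ-arcs z z' z→z' with arc-ι-preimage z z' z→z'
    ... | a , b , refl , refl , a→b with ψ-arcs a b a→b
    ...   | inj₁ (x , y , refl , refl) = inj₁ (fsuc x , fsuc y , refl , refl)
    ...   | inj₂ (x , y , refl , refl) with σ₂-covers x | σ₂-covers y
    ...     | x' , σx' | y' , σy' = inj₂ (x' , y' , σx' , σy')

  glue-extend-side : ∀ {K₁ K₂} (G : Gluing K₁ K₂ (config D C f)) (a : Fin (n (Config.D K₁)))
    → Gluing.φ₁ G a ≡ v → a ≢ Gluing.v₁ G
    → Gluing (addIsolatedConfig K₁ a) K₂ (config D C' f')
  glue-extend-side {K₁} {K₂} G a φ₁a≡v a≢v₁ = record
    { base = base
    ; ψ₁ = lift ψ₁
    ; ψ₂ = ι ∘ ψ₂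
    ; ψ₁-injective = lift-injective ψ₁-injective
    ; ψ₂-injective = λ x y → ψ₂-injective x y ∘ ι-injective _ _
    ; ψ₁-X = lift-X {φ = φ₁} φ₁a≡v ψ₁-X
    ; ψ₂-X = λ y → trans (X-ι _) (ψ₂-X y)
    ; ψ₁-glued = glued₁
    ; ψ₂-glued = λ y Xy≡v₂ → Product.map fsuc (cong ι) (ψ₂-glued y Xy≡v₂)
    ; ψ-cover = lift-cover (λ y → y , refl) ψ-cover
    ; ψ₁-arc = lift-arc ψ₁-arc
    ; ψ₂-arc = λ x y → trans (ι-arc _ _) (ψ₂-arc x y)
    ; ψ-arcs = lift-arcs (λ y → y , refl) ψ-arcs
    ; ψ₁-f = lift-f ψ₁-f
    ; ψ₂-f = λ y Xy≢v₂ → trans (f-ι _) (ψ₂-f y Xy≢v₂)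
    ; ψ-f-glued = f-glued
    }
    where
    open Gluing G
    glued₁ : ∀ x → X (addIsolatedCover (cov K₁) a) x ≡ v₁ → InImage (ι ∘ ψ₂) (lift ψ₁ x)
    glued₁ fzero    a≡v₁  = contradiction a≡v₁ a≢v₁
    glued₁ (fsuc x) Xx≡v₁ = Product.map₂ (cong ι) (ψ₁-glued x Xx≡v₁)
    f-glued : ∀ x y → lift ψ₁ x ≡ ι (ψ₂ y)
            → f' (lift ψ₁ x) ≡ zeroAtNew (Config.f K₁) x ⊕ Config.f K₂ y
    f-glued fzero    y eq = contradiction (sym eq) (ι≢new _)
    f-glued (fsuc x) y eq = trans (f-ι _) (ψ-f-glued x y (ι-injective _ _ eq))

  glue-extend-glued : ∀ {K₁ K₂} (G : Gluing K₁ K₂ (config D C f))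
    → Gluing.φ₁ G (Gluing.v₁ G) ≡ v
    → Gluing (addIsolatedConfig K₁ (Gluing.v₁ G)) (addIsolatedConfig K₂ (Gluing.v₂ G)) (config D C' f')
  glue-extend-glued {K₁} {K₂} G φ₁v₁≡v = record
    { base = base
    ; ψ₁ = lift ψ₁
    ; ψ₂ = lift ψ₂
    ; ψ₁-injective = lift-injective ψ₁-injective
    ; ψ₂-injective = lift-injective ψ₂-injective
    ; ψ₁-X = lift-X {φ = φ₁} φ₁v₁≡v ψ₁-X
    ; ψ₂-X = lift-X {φ = φ₂} (trans (sym φ-glued) φ₁v₁≡v) ψ₂-X
    ; ψ₁-glued = glued ψ₁-glued
    ; ψ₂-glued = glued ψ₂-glued
    ; ψ-cover = lift-cover (λ y → fsuc y , refl) ψ-cover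
    ; ψ₁-arc = lift-arc ψ₁-arc
    ; ψ₂-arc = lift-arc ψ₂-arc
    ; ψ-arcs = lift-arcs (λ y → fsuc y , refl) ψ-arcs
    ; ψ₁-f = lift-f ψ₁-f
    ; ψ₂-f = lift-f ψ₂-f
    ; ψ-f-glued = f-glued
    }
    where
    open Gluing G
    glued : ∀ {m m'} {χ : Fin m → VH C} {χ' : Fin m' → VH C} {P : Fin (suc m) → Set}
          → (∀ x → P (fsuc x) → InImage χ' (χ x)) → ∀ x → P x → InImage (lift χ') (lift χ x)
    glued χ-glued fzero    _ = fzero , refl
    glued χ-glued (fsuc x) p = Product.map fsuc (cong ι) (χ-glued x p)
    f-glued : ∀ x y → lift ψ₁ x ≡ lift ψ₂ y
            → f' (lift ψ₁ x) ≡ zeroAtNew (Config.f K₁) x ⊕ zeroAtNew (Config.f K₂) y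
    f-glued fzero    fzero    _  = f-new
    f-glued fzero    (fsuc y) eq = contradiction (sym eq) (ι≢new _)
    f-glued (fsuc x) fzero    eq = contradiction eq (ι≢new _)
    f-glued (fsuc x) (fsuc y) eq = trans (f-ι _) (ψ-f-glued x y (ι-injective _ _ eq))

extension-constructible : ∀ {K C' f'} → Constructible K
  → IsolatedExtension (cov K) (f K) C' f' → Constructible (config (D K) C' f')
extension-constructible (typeI D₀ _ _ T block sat f-T f-off) E =
  typeI D₀ _ _ (transversal T) block (transversal-saturated T sat)
    (λ u → trans (transversal-f T u) (f-T u))
    (λ x x∉T → f'-vanishes x λ a ιa≡x → f-off a (notInT-ι T ιa≡x x∉T))
  where open Extension E
extension-constructible (typeII D₀ _ _ m p ns Ts complete p≥1 ns≥1 Σns disj sat f-T f-off) E =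
  typeII D₀ _ _ m p ns (transversal ∘ Ts) complete p≥1 ns≥1 Σns
    (λ i j i≢j → transversal-disjoint (Ts i) (Ts j) (disj i j i≢j))
    (λ i → transversal-saturated (Ts i) (sat i))
    (λ i u → trans (transversal-f (Ts i) u) (f-T i u))
    (λ x x∉T → f'-vanishes x λ a ιa≡x → f-off a λ i → notInT-ι (Ts i) ιa≡x (x∉T i))
  where open Extension E
extension-constructible (typeIII D₀ _ _ m T₁ T₂ cycle m≥5 odd disj sat₁ sat₂ f-T₁ f-T₂ f-off) E =
  typeIII D₀ _ _ m (transversal T₁) (transversal T₂) cycle m≥5 odd (transversal-disjoint T₁ T₂ disj)
    (transversal-saturated T₁ sat₁) (transversal-saturated T₂ sat₂)
    (λ u → trans (transversal-f T₁ u) (f-T₁ u)) (λ u → trans (transversal-f T₂ u) (f-T₂ u))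
    (f'-vanishes-outside₂ T₁ T₂ f-off)
  where open Extension E
extension-constructible (typeIV D₀ _ _ m T₁ T₂ cycle m≥4 even disj induced f-T₁ f-T₂ f-off) E =
  typeIV D₀ _ _ m (transversal T₁) (transversal T₂) cycle m≥4 even (transversal-disjoint T₁ T₂ disj)
    (inducedHas-transversals T₁ T₂ (2 * m) (IsDpmCycle (2 * m)) isDpmCycle-resp induced)
    (λ u → trans (transversal-f T₁ u) (f-T₁ u)) (λ u → trans (transversal-f T₂ u) (f-T₂ u))
    (f'-vanishes-outside₂ T₁ T₂ f-off)
  where open Extension E
extension-constructible (typeV D₀ _ _ m T₁ T₂ cycle m≥4 even disj induced f-src f-snk f-off) E =
  typeV D₀ _ _ m (transversal T₁) (transversal T₂) cycle m≥4 even (transversal-disjoint T₁ T₂ disj)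
    (inducedHas-transversals T₁ T₂ (2 * m) (IsAntiCycle (2 * m)) isAntiCycle-resp induced)
    (λ u src → Product.map (trans (transversal-f T₁ u)) (trans (transversal-f T₂ u)) (f-src u src))
    (λ u snk → Product.map (trans (transversal-f T₁ u)) (trans (transversal-f T₂ u)) (f-snk u snk))
    (f'-vanishes-outside₂ T₁ T₂ f-off)
  where open Extension E
extension-constructible {C' = C'} {f'} (typeVI K₁ K₂ K c₁ c₂ |D₁|<|D| |D₂|<|D| glue) E =
  reglue (location v)
  where
  open IsolatedExtension E using (v)
  open GluingExtension E
  G : Gluing K₁ K₂ K
  G = fromGlue glue
  open Gluing G
  K' : Config
  K' = config (D K) C' f'
  extend₁ : ∀ a → Constructible (addIsolatedConfig K₁ a)
  extend₁ a = extension-constructible c₁ (addIsolated-extension K₁ a)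
  extend₂ : ∀ b → Constructible (addIsolatedConfig K₂ b)
  extend₂ b = extension-constructible c₂ (addIsolated-extension K₂ b)
  reglue : φ₁ v₁ ≡ v ⊎ (∃[ a ] a ≢ v₁ × φ₁ a ≡ v) ⊎ (∃[ b ] b ≢ v₂ × φ₂ b ≡ v)
         → Constructible K'
  reglue (inj₁ φ₁v₁≡v) =
    typeVI _ _ K' (extend₁ v₁) (extend₂ v₂) |D₁|<|D| |D₂|<|D| (toGlue (glue-extend-glued G φ₁v₁≡v))
  reglue (inj₂ (inj₁ (a , a≢v₁ , φ₁a≡v))) =
    typeVI _ K₂ K' (extend₁ a) c₂ |D₁|<|D| |D₂|<|D| (toGlue (glue-extend-side G a φ₁a≡v a≢v₁))
  reglue (inj₂ (inj₂ (b , b≢v₂ , φ₂b≡v))) =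
    typeVI _ K₁ K' (extend₂ b) c₁ |D₂|<|D| |D₁|<|D|
      (toGlue (glue-extend-side (Gluing-sym G) b φ₂b≡v b≢v₂))

proposition16 : (D : Digraph) (C C' : Cover D)
    (f : VH C → ℕ × ℕ) (f' : VH C' → ℕ × ℕ)
    → Constructible (config D C f)
    → (v : Fin (n D)) (xv : VH C') (ι : VH C → VH C')
    → (∀ y → arc (H C') xv y ≡ false × arc (H C') y xv ≡ false)
    → Injective ι
    → (∀ a → ι a ≢ xv)
    → (∀ y → y ≢ xv → ∃[ a ] ι a ≡ y)
    → (∀ a b → arc (H C') (ι a) (ι b) ≡ arc (H C) a b)
    → X C' xv ≡ v
    → (∀ a → X C' (ι a) ≡ X C a)
    → f' xv ≡ (0 , 0)
    → (∀ a → f' (ι a) ≡ f a)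
    → Constructible (config D C' f')
proposition16 D C C' f f' constructible v xv ι xv-isolated ι-inj ι≢xv ι-onto ι-arc X-xv X-ι f-xv f-ι =
  extension-constructible constructible
    (isolatedExtension v xv ι xv-isolated ι-inj ι≢xv ι-onto ι-arc X-xv X-ι f-xv f-ι)
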